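{- Given a root ideal $\Psi\subset\Delta^+_{\ell+1}$, a multiset $M$ on $[\ell+1]$, and $\gamma\in\mathbb Z^\ell$, we have $K(\Psi;M;(\gamma,0))=K(\hat\Psi;\hat M;\gamma)$, where $\hat\Psi=\{(i,j)\in\Psi:1\le i<j\le\ell\}$ and $\hat M=\{j\in M:1\le j\le\ell\}$ (with multiplicity).
   Context: $h_d$ complete homogeneous symmetric functions ($h_0=1$, $h_d=0$ for $d<0$); $k^{(r)}_m=\sum_{i=0}^m\binom{r+i-1}{i}h_{m-i}$ with $\binom n0=1$, $\binom ni=n(n-1)\cdots(n-i+1)/i!$; $g_\gamma=\det(k^{(i-1)}_{\gamma_i+j-i})_{1\le i,j\le n}$ for $\gamma\in\mathbb Z^n$. $\Delta^+_n=\{(i,j):1\le i<j\le n\}$; a root ideal is an upper order ideal for $(a,b)\le(c,d)\iff a\ge c,b\le d$. For a root ideal $\Psi\subset\Delta^+_n$, a multiset $M$ with support in $[n]$ and $\gamma\in\mathbb Z^n$, $K(\Psi;M;\gamma)=g\big(\prod_{(a,b)\in\Psi}(1-z_a/z_b)^{ -1}\prod_{b\in M}(1-1/z_b)\mathbf z^\gamma\big)$, expanded in $\mathbb Z[[z_1/z_2,\dots,z_{n-1}/z_n]][z_1^{\pm1},\dots,z_n^{\pm1}]$ with $g:\mathbf z^\gamma\mapsto g_\gamma$ additive. -}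

module Defs where

open import Level using (Level)
open import Function using (_∘_)
open import Algebra.Bundles using (CommutativeRing)
open import Data.Nat as ℕ using (ℕ; zero; suc; _∸_)
open import Data.Nat.Combinatorics using (_C_)
open import Data.Integer as ℤ using (ℤ; +_; -[1+_])
open import Data.Fin as Fin using (Fin; zero; suc; toℕ; inject₁; punchIn)
open import Data.Bool using (Bool; true; false; if_then_else_)
open import Data.List using (List; []; _∷_; allFin; foldr; concatMap; replicate)
open import Data.Product using (_×_; _,_)
open import Relation.Nullary.Decidable using (does)
open import Relation.Binary.PropositionalEquality using (_≡_)

-- Root ideals in Δ⁺_n, indices 0-based (Fin n ≅ [n]); Ψ a b = true means (a,b) ∈ Ψ.
IsRootIdeal : ∀ {n} → (Fin n → Fin n → Bool) → Set
IsRootIdeal {n} Ψ =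
  (∀ a b → Ψ a b ≡ true → a Fin.< b) ×
  (∀ a b c d → Ψ a b ≡ true → c Fin.≤ a → b Fin.≤ d → Ψ c d ≡ true)

ext0 : ∀ {l} → (Fin l → ℤ) → Fin (suc l) → ℤ
ext0 {zero}  γ zero    = + 0
ext0 {suc l} γ zero    = γ zero
ext0 {suc l} γ (suc i) = ext0 (γ ∘ suc) i

Ψhat : ∀ {l} → (Fin (suc l) → Fin (suc l) → Bool) → Fin l → Fin l → Bool
Ψhat Ψ a b = Ψ (inject₁ a) (inject₁ b)

Mhat : ∀ {l} → (Fin (suc l) → ℕ) → Fin l → ℕ
Mhat M b = M (inject₁ b)

upd : ∀ {n} → (Fin n → ℤ) → Fin n → ℤ → Fin n → ℤ
upd γ c v i = if does (i Fin.≟ c) then γ i ℤ.+ v else γ i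

roots : ∀ {n} → (Fin n → Fin n → Bool) → List (Fin n × Fin n)
roots {n} Ψ = concatMap (λ a → concatMap (λ b → if Ψ a b then (a , b) ∷ [] else []) (allFin n)) (allFin n)

melems : ∀ {n} → (Fin n → ℕ) → List (Fin n)
melems {n} M = concatMap (λ b → replicate (M b) b) (allFin n)

-- generalized binomial  binom(r+i-1, i)  for r,i ≥ 0 (binom(-1,0)=1, binom(i-1,i)=0 for i ≥ 1)
binomGen : ℕ → ℕ → ℕ
binomGen r i = (r ℕ.+ i ∸ 1) C i

module _ {c ℓ} (R : CommutativeRing c ℓ) where
  open CommutativeRing R using (Carrier; _+_; _*_; -_; _-_; 0#; 1#)

  natR : ℕ → Carrier
  natR zero    = 0#
  natR (suc n) = 1# + natR n

  sumℕ : ℕ → (ℕ → Carrier) → Carrier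
  sumℕ zero    f = 0#
  sumℕ (suc n) f = sumℕ n f + f n

  sumFin : ∀ n → (Fin n → Carrier) → Carrier
  sumFin zero    f = 0#
  sumFin (suc n) f = f zero + sumFin n (f ∘ suc)

  sign : ℕ → Carrier
  sign zero    = 1#
  sign (suc j) = - sign j

  det : ∀ n → (Fin n → Fin n → Carrier) → Carrier
  det zero    A = 1#
  det (suc n) A = sumFin (suc n) λ j →
    sign (toℕ j) * A zero j * det n (λ i j' → A (suc i) (punchIn j j'))

  -- e d plays the role of h_{d+1}; since Λ = ℤ[h₁,h₂,…] is free, an identity in Λ
  -- is the same as the identity for every commutative ring and every sequence e.
  module _ (e : ℕ → Carrier) where

    h : ℤ → Carrier
    h -[1+ _ ]  = 0#
    h (+ zero)  = 1#
    h (+ suc d) = e d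

    k : ℕ → ℤ → Carrier
    k r -[1+ _ ] = 0#
    k r (+ m)    = sumℕ (suc m) (λ i → natR (binomGen r i) * h (+ m ℤ.- + i))

    g : ∀ n → (Fin n → ℤ) → Carrier
    g n γ = det n (λ i j → k (toℕ i) (γ i ℤ.+ + toℕ j ℤ.- + toℕ i))

    -- A functional F represents γ ↦ g(Φ z^γ) for a series Φ.
    -- multiply Φ by (1 - 1/z_b):
    lowerOp : ∀ {n} → Fin n → ((Fin n → ℤ) → Carrier) → (Fin n → ℤ) → Carrier
    lowerOp b F γ = F γ - F (upd γ b (ℤ.- + 1))

    -- multiply Φ by Σ_{t=0}^{N} (z_a/z_b)^t  (truncation of (1 - z_a/z_b)^{-1})
    raiseOp : ∀ {n} → ℕ → Fin n × Fin n → ((Fin n → ℤ) → Carrier) → (Fin n → ℤ) → Carrier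
    raiseOp N (a , b) F γ = sumℕ (suc N) (λ t → F (upd (upd γ a (+ t)) b (ℤ.- (+ t))))

    -- K_N(Ψ;M;γ): K(Ψ;M;γ) with each geometric series truncated at degree N
    Kt : ∀ {n} → ℕ → (Fin n → Fin n → Bool) → (Fin n → ℕ) → (Fin n → ℤ) → Carrier
    Kt {n} N Ψ M = foldr (raiseOp N) (foldr lowerOp (g n) (melems M)) (roots Ψ)

{-# OPTIONS --safe #-}
module Submission where

-- Say that a functional F on ℤ^(ℓ+1)
-- restricts to H on ℤ^ℓ if F(γ,0) = H γ and F(γ,−m) = 0 for m > 0.  Then g restricts to g:
-- when the last entry is 0 the last row of the Jacobi–Trudi matrix is (0,…,0,1), and when it
-- is negative that row vanishes.  Operators indexed inside [ℓ] preserve the relation, while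
-- one involving ℓ+1 (the index ℓ+1 in M, or a root (a,ℓ+1)) only adds terms of negative last
-- entry, so it can be deleted; roots (ℓ+1,b) do not exist.

open import Defs
open import Algebra.Bundles using (CommutativeRing)
open import Data.Nat using (ℕ; suc; _≤_)
open import Data.Integer using (ℤ)
open import Data.Fin using (Fin)
open import Data.Bool using (Bool)
open import Data.Product using (∃-syntax)

open import Level using (_⊔_)
open import Function using (_∘_; id)
open import Data.Nat using (zero)
import Data.Nat.Properties as ℕP
open import Data.Integer as ℤ using (+_; -[1+_]; +0; -<+; +<+; +≤+)
import Data.Integer.Properties as ℤP
open import Data.Fin as Fin using (zero; suc; toℕ; inject₁; fromℕ; punchIn)
import Data.Fin.Properties as FinP
open import Data.Bool using (true; false; if_then_else_)
open import Data.List
  using (List; []; _∷_; _++_; concat; concatMap; tabulate; allFin; replicate; foldr)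
import Data.List.Properties as ListP
open import Data.Product as Product using (_,_; proj₁)
open import Data.Empty using (⊥-elim)
open import Relation.Nullary using (¬_; yes; no)
open import Relation.Nullary.Decidable using (dec-true; dec-false)
open import Relation.Binary.PropositionalEquality as ≡
  using (_≡_; _≢_; _≗_; refl; cong; subst)

concatMap-allFin : ∀ {a n} {A : Set a} (f : Fin n → List A) →
                   concatMap f (allFin n) ≡ concat (tabulate f)
concatMap-allFin f = cong concat (ListP.map-tabulate id f)

data Pruning {a b p q} {A : Set a} {B : Set b} (D : A → Set p) (E : A → B → Set q) :
             List A → List B → Set (a ⊔ b ⊔ p ⊔ q) where
  []    : Pruning D E [] []
  prune : ∀ {x xs ys} → D x → Pruning D E xs ys → Pruning D E (x ∷ xs) ys
  _∷_   : ∀ {x y xs ys} → E x y → Pruning D E xs ys → Pruning D E (x ∷ xs) (y ∷ ys)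

module _ {a b p q} {A : Set a} {B : Set b} {D : A → Set p} {E : A → B → Set q} where

  ++⁺ : ∀ {xs ys xs′ ys′} → Pruning D E xs ys → Pruning D E xs′ ys′ →
        Pruning D E (xs ++ xs′) (ys ++ ys′)
  ++⁺ []           qs = qs
  ++⁺ (prune d ps) qs = prune d (++⁺ ps qs)
  ++⁺ (e ∷ ps)     qs = e ∷ ++⁺ ps qs

  replicate⁺ : ∀ n {x y} → E x y → Pruning D E (replicate n x) (replicate n y)
  replicate⁺ zero    e = []
  replicate⁺ (suc n) e = e ∷ replicate⁺ n e

  replicate-prune : ∀ n {x} → D x → Pruning D E (replicate n x) []
  replicate-prune zero    d = []
  replicate-prune (suc n) d = prune d (replicate-prune n d)

  concat-tabulate⁺ : ∀ n (f : Fin (suc n) → List A) (f′ : Fin n → List B) →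
                     (∀ i → Pruning D E (f (inject₁ i)) (f′ i)) →
                     Pruning D E (f (fromℕ n)) [] →
                     Pruning D E (concat (tabulate f)) (concat (tabulate f′))
  concat-tabulate⁺ zero    f f′ _    last = ++⁺ last []
  concat-tabulate⁺ (suc n) f f′ init last =
    ++⁺ (init zero) (concat-tabulate⁺ n (f ∘ suc) (f′ ∘ suc) (init ∘ suc) last)

  concat-tabulate-prune : ∀ n (f : Fin n → List A) → (∀ i → Pruning D E (f i) []) →
                          Pruning D E (concat (tabulate f)) []
  concat-tabulate-prune zero    f all = []
  concat-tabulate-prune (suc n) f all =
    ++⁺ (all zero) (concat-tabulate-prune n (f ∘ suc) (all ∘ suc))

  concatMap-allFin⁺ : ∀ n (f : Fin (suc n) → List A) (f′ : Fin n → List B) →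
                      (∀ i → Pruning D E (f (inject₁ i)) (f′ i)) →
                      Pruning D E (f (fromℕ n)) [] →
                      Pruning D E (concatMap f (allFin (suc n))) (concatMap f′ (allFin n))
  concatMap-allFin⁺ n f f′ init last
    rewrite concatMap-allFin f | concatMap-allFin f′ = concat-tabulate⁺ n f f′ init last

  concatMap-allFin-prune : ∀ n (f : Fin n → List A) → (∀ i → Pruning D E (f i) []) →
                           Pruning D E (concatMap f (allFin n)) []
  concatMap-allFin-prune n f all rewrite concatMap-allFin f = concat-tabulate-prune n f all

  foldr⁺ : ∀ {x y s} {X : Set x} {Y : Set y} (S : X → Y → Set s)
           {f : A → X → X} {g : B → Y → Y} →
           (∀ {a u v} → D a → S u v → S (f a u) v) →
           (∀ {a b u v} → E a b → S u v → S (f a u) (g b v)) →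
           ∀ {xs ys u v} → Pruning D E xs ys → S u v → S (foldr f u xs) (foldr g v ys)
  foldr⁺ S pruned kept []           s = s
  foldr⁺ S pruned kept (prune d ps) s = pruned d (foldr⁺ S pruned kept ps s)
  foldr⁺ S pruned kept (e ∷ ps)     s = kept e (foldr⁺ S pruned kept ps s)

punchIn-inject₁ : ∀ {n} (i : Fin (suc n)) (j : Fin n) →
                  punchIn (inject₁ i) (inject₁ j) ≡ inject₁ (punchIn i j)
punchIn-inject₁ zero    j       = refl
punchIn-inject₁ (suc i) zero    = refl
punchIn-inject₁ (suc i) (suc j) = cong suc (punchIn-inject₁ i j)

punchIn-inject₁-fromℕ : ∀ {n} (i : Fin (suc n)) →
                        punchIn (inject₁ i) (fromℕ n) ≡ fromℕ (suc n)
punchIn-inject₁-fromℕ         zero    = refl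
punchIn-inject₁-fromℕ {suc n} (suc i) = cong suc (punchIn-inject₁-fromℕ i)

punchIn-fromℕ : ∀ {n} (j : Fin n) → punchIn (fromℕ n) j ≡ inject₁ j
punchIn-fromℕ {suc n} zero    = refl
punchIn-fromℕ {suc n} (suc j) = cong suc (punchIn-fromℕ j)

fromℕ≮ : ∀ {n} (i : Fin (suc n)) → ¬ fromℕ n Fin.< i
fromℕ≮ i = ℕP.≤⇒≯ (FinP.≤fromℕ i)

i<j⇒i-j<0 : ∀ {i j} → i ℤ.< j → i ℤ.- j ℤ.< +0
i<j⇒i-j<0 {i} {j} i<j = subst (i ℤ.- j ℤ.<_) (ℤP.+-inverseʳ j) (ℤP.+-monoˡ-< (ℤ.- j) i<j)

i≤0⇒i+-[1+n]<0 : ∀ {i} n → i ℤ.≤ +0 → i ℤ.+ -[1+ n ] ℤ.< +0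
i≤0⇒i+-[1+n]<0 n i≤0 = ℤP.+-mono-≤-< i≤0 -<+

ext0-inject₁ : ∀ {l} (γ : Fin l → ℤ) → ext0 γ ∘ inject₁ ≗ γ
ext0-inject₁ {suc l} γ zero    = refl
ext0-inject₁ {suc l} γ (suc i) = ext0-inject₁ (γ ∘ suc) i

ext0-fromℕ : ∀ {l} (γ : Fin l → ℤ) → ext0 γ (fromℕ l) ≡ +0
ext0-fromℕ {zero}  γ = refl
ext0-fromℕ {suc l} γ = ext0-fromℕ (γ ∘ suc)

module _ {n} (γ : Fin n → ℤ) (c : Fin n) (v : ℤ) where

  upd-≡ : upd γ c v c ≡ γ c ℤ.+ v
  upd-≡ rewrite dec-true (c Fin.≟ c) refl = refl

  upd-≢ : ∀ {i} → i ≢ c → upd γ c v i ≡ γ i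
  upd-≢ {i} i≢c rewrite dec-false (i Fin.≟ c) i≢c = refl

upd-+0 : ∀ {n} (γ : Fin n → ℤ) c → upd γ c +0 ≗ γ
upd-+0 γ c i with i Fin.≟ c
... | yes _ = ℤP.+-identityʳ (γ i)
... | no  _ = refl

module _ {l} (δ : Fin (suc l) → ℤ) where

  upd-inject₁ : ∀ {γ} c v → δ ∘ inject₁ ≗ γ →
                upd δ (inject₁ c) v ∘ inject₁ ≗ upd γ c v
  upd-inject₁ {γ} c v δ≗γ i with i Fin.≟ c
  ... | yes refl = ≡.trans (upd-≡ δ (inject₁ c) v) (cong (ℤ._+ v) (δ≗γ c))
  ... | no  i≢c  =
    ≡.trans (upd-≢ δ (inject₁ c) v (i≢c ∘ FinP.inject₁-injective)) (δ≗γ i)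

  upd-inject₁-fromℕ : ∀ c v → upd δ (inject₁ c) v (fromℕ l) ≡ δ (fromℕ l)
  upd-inject₁-fromℕ c v = upd-≢ δ (inject₁ c) v FinP.fromℕ≢inject₁

raise : ∀ {n} → Fin n → Fin n → ℕ → (Fin n → ℤ) → Fin n → ℤ
raise a b t γ = upd (upd γ a (+ t)) b (ℤ.- + t)

raise-0 : ∀ {n} (a b : Fin n) (γ : Fin n → ℤ) → raise a b 0 γ ≗ γ
raise-0 a b γ i = ≡.trans (upd-+0 (upd γ a +0) b i) (upd-+0 γ a i)

module _ {l} (δ : Fin (suc l) → ℤ) (a : Fin l) (t : ℕ) where

  raise-inject₁ : ∀ {γ} b → δ ∘ inject₁ ≗ γ →
                  raise (inject₁ a) (inject₁ b) t δ ∘ inject₁ ≗ raise a b t γ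
  raise-inject₁ b = upd-inject₁ (upd δ (inject₁ a) (+ t)) b (ℤ.- + t) ∘ upd-inject₁ δ a (+ t)

  raise-inject₁-fromℕ : ∀ b → raise (inject₁ a) (inject₁ b) t δ (fromℕ l) ≡ δ (fromℕ l)
  raise-inject₁-fromℕ b =
    ≡.trans (upd-inject₁-fromℕ (upd δ (inject₁ a) (+ t)) b (ℤ.- + t)) (upd-inject₁-fromℕ δ a (+ t))

  raise-fromℕ : raise (inject₁ a) (fromℕ l) t δ (fromℕ l) ≡ δ (fromℕ l) ℤ.- + t
  raise-fromℕ = ≡.trans (upd-≡ (upd δ (inject₁ a) (+ t)) (fromℕ l) (ℤ.- + t))
                      (cong (ℤ._- + t) (upd-inject₁-fromℕ δ a (+ t)))

module _ {l : ℕ} where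
  private
    L : Fin (suc l)
    L = fromℕ l

  melems-pruning : (M : Fin (suc l) → ℕ) →
                   Pruning (_≡ L) (λ x y → x ≡ inject₁ y) (melems M) (melems (Mhat M))
  melems-pruning M =
    concatMap-allFin⁺ l _ _ (λ i → replicate⁺ (M (inject₁ i)) refl) (replicate-prune (M L) refl)

  roots-pruning : (Ψ : Fin (suc l) → Fin (suc l) → Bool) → (∀ a b → Ψ a b ≡ true → a Fin.< b) →
                  Pruning (λ r → ∃[ a ] r ≡ (inject₁ a , L))
                          (λ r s → r ≡ Product.map inject₁ inject₁ s)
                          (roots Ψ) (roots (Ψhat Ψ))
  roots-pruning Ψ increasing =
    concatMap-allFin⁺ l _ _ (λ a → concatMap-allFin⁺ l _ _ (keep a) (lastColumn a))
                            (concatMap-allFin-prune (suc l) _ lastRow)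
    where
    keep : ∀ a b →
           Pruning _ _ (if Ψ (inject₁ a) (inject₁ b) then (inject₁ a , inject₁ b) ∷ [] else [])
                       (if Ψhat Ψ a b then (a , b) ∷ [] else [])
    keep a b with Ψ (inject₁ a) (inject₁ b)
    ... | true  = refl ∷ []
    ... | false = []

    lastColumn : ∀ a → Pruning _ _ (if Ψ (inject₁ a) L then (inject₁ a , L) ∷ [] else []) []
    lastColumn a with Ψ (inject₁ a) L
    ... | true  = prune (a , refl) []
    ... | false = []

    lastRow : ∀ b → Pruning _ _ (if Ψ L b then (L , b) ∷ [] else []) []
    lastRow b with Ψ L b in Ψ[L,b]
    ... | true  = ⊥-elim (fromℕ≮ b (increasing L b Ψ[L,b]))
    ... | false = []

module _ {c ℓ} (R : CommutativeRing c ℓ) where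
  open CommutativeRing R renaming (refl to ≈-refl) hiding (zero)
  open import Algebra.Properties.Ring ring using (-0#≈0#)
  open import Relation.Binary.Reasoning.Setoid setoid

  x-0#≈x : ∀ x → x - 0# ≈ x
  x-0#≈x x = trans (+-congˡ -0#≈0#) (+-identityʳ x)

  sumFin-cong : ∀ n {f g : Fin n → Carrier} → (∀ i → f i ≈ g i) →
                sumFin R n f ≈ sumFin R n g
  sumFin-cong zero    f≈g = ≈-refl
  sumFin-cong (suc n) f≈g = +-cong (f≈g zero) (sumFin-cong n (f≈g ∘ suc))

  sumFin-≈0 : ∀ n {f : Fin n → Carrier} → (∀ i → f i ≈ 0#) → sumFin R n f ≈ 0#
  sumFin-≈0 zero    f≈0 = ≈-refl
  sumFin-≈0 (suc n) f≈0 =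
    trans (+-cong (f≈0 zero) (sumFin-≈0 n (f≈0 ∘ suc))) (+-identityʳ 0#)

  sumFin-init-last : ∀ n (f : Fin (suc n) → Carrier) →
                     sumFin R (suc n) f ≈ sumFin R n (f ∘ inject₁) + f (fromℕ n)
  sumFin-init-last zero    f = trans (+-identityʳ (f zero)) (sym (+-identityˡ (f zero)))
  sumFin-init-last (suc n) f =
    trans (+-congˡ (sumFin-init-last n (f ∘ suc))) (sym (+-assoc _ _ _))

  sumℕ-cong : ∀ n {f g : ℕ → Carrier} → (∀ i → f i ≈ g i) →
              sumℕ R n f ≈ sumℕ R n g
  sumℕ-cong zero    f≈g = ≈-refl
  sumℕ-cong (suc n) f≈g = +-cong (sumℕ-cong n f≈g) (f≈g n)

  sumℕ-≈0 : ∀ n {f : ℕ → Carrier} → (∀ i → f i ≈ 0#) → sumℕ R n f ≈ 0#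
  sumℕ-≈0 zero    f≈0 = ≈-refl
  sumℕ-≈0 (suc n) f≈0 = trans (+-cong (sumℕ-≈0 n f≈0) (f≈0 n)) (+-identityʳ 0#)

  sumℕ-head : ∀ n {f : ℕ → Carrier} → (∀ i → f (suc i) ≈ 0#) → sumℕ R (suc n) f ≈ f 0
  sumℕ-head zero    f≈0 = +-identityˡ _
  sumℕ-head (suc n) f≈0 = trans (+-cong (sumℕ-head n f≈0) (f≈0 n)) (+-identityʳ _)

  minor : ∀ {n} → (Fin (suc n) → Fin (suc n) → Carrier) →
          Fin (suc n) → Fin n → Fin n → Carrier
  minor A j i j′ = A (suc i) (punchIn j j′)

  laplaceTerm : ∀ n → (Fin (suc n) → Fin (suc n) → Carrier) → Fin (suc n) → Carrier
  laplaceTerm n A j = sign R (toℕ j) * A zero j * det R n (minor A j)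

  det-cong : ∀ n {A B : Fin n → Fin n → Carrier} → (∀ i j → A i j ≈ B i j) →
             det R n A ≈ det R n B
  det-cong zero    A≈B = ≈-refl
  det-cong (suc n) {A} {B} A≈B =
    sumFin-cong (suc n) {laplaceTerm n A} {laplaceTerm n B} λ j →
      *-cong (*-congˡ (A≈B zero j)) (det-cong n (λ i j′ → A≈B (suc i) (punchIn j j′)))

  det-zeroLastRow : ∀ n (A : Fin (suc n) → Fin (suc n) → Carrier) →
                    (∀ j → A (fromℕ n) j ≈ 0#) → det R (suc n) A ≈ 0#
  det-zeroLastRow zero    A last≈0 = sumFin-≈0 1 {laplaceTerm 0 A} λ where
    zero → trans (*-identityʳ _) (trans (*-congˡ (last≈0 zero)) (zeroʳ _))
  det-zeroLastRow (suc n) A last≈0 = sumFin-≈0 (suc (suc n)) {laplaceTerm (suc n) A} λ j →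
    trans (*-congˡ (det-zeroLastRow n (minor A j) (last≈0 ∘ punchIn j))) (zeroʳ _)

  det-unitLastRow : ∀ n (A : Fin (suc n) → Fin (suc n) → Carrier) →
                    (∀ j → A (fromℕ n) (inject₁ j) ≈ 0#) → A (fromℕ n) (fromℕ n) ≈ 1# →
                    det R (suc n) A ≈ det R n (λ i j → A (inject₁ i) (inject₁ j))
  det-unitLastRow zero A _ corner≈1 =
    trans (+-identityʳ _) (trans (*-identityʳ _) (trans (*-identityˡ _) corner≈1))
  det-unitLastRow (suc n) A last≈0 corner≈1 = begin
    det R (suc (suc n)) A
      ≈⟨ sumFin-init-last (suc n) (laplaceTerm (suc n) A) ⟩
    sumFin R (suc n) (laplaceTerm (suc n) A ∘ inject₁) + laplaceTerm (suc n) A (fromℕ (suc n))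
      ≈⟨ +-cong (sumFin-cong (suc n) keptColumn) lastColumn≈0 ⟩
    det R (suc n) B + 0#
      ≈⟨ +-identityʳ _ ⟩
    det R (suc n) B ∎
    where
    B : Fin (suc n) → Fin (suc n) → Carrier
    B i j = A (inject₁ i) (inject₁ j)

    lastColumn≈0 : laplaceTerm (suc n) A (fromℕ (suc n)) ≈ 0#
    lastColumn≈0 = trans
      (*-congˡ (det-zeroLastRow n (minor A (fromℕ (suc n))) λ j →
        trans (reflexive (cong (A (fromℕ (suc n))) (punchIn-fromℕ j))) (last≈0 j)))
      (zeroʳ _)

    minor≈ : ∀ j → det R (suc n) (minor A (inject₁ j)) ≈ det R n (minor B j)
    minor≈ j = trans
      (det-unitLastRow n (minor A (inject₁ j))
        (λ j′ → trans (reflexive (cong (A (fromℕ (suc n))) (punchIn-inject₁ j j′)))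
                      (last≈0 (punchIn j j′)))
        (trans (reflexive (cong (A (fromℕ (suc n))) (punchIn-inject₁-fromℕ j))) corner≈1))
      (det-cong n λ i j′ → reflexive (cong (A (suc (inject₁ i))) (punchIn-inject₁ j j′)))

    keptColumn : ∀ j → laplaceTerm (suc n) A (inject₁ j) ≈ laplaceTerm n B j
    keptColumn j = *-cong (*-congʳ (reflexive (cong (sign R) (FinP.toℕ-inject₁ j)))) (minor≈ j)

module Restriction {c ℓ} (R : CommutativeRing c ℓ) (e : ℕ → CommutativeRing.Carrier R) (l : ℕ)
  where
  open CommutativeRing R renaming (refl to ≈-refl) hiding (zero)

  private
    L : Fin (suc l)
    L = fromℕ l

  Functional : ℕ → Set c
  Functional n = (Fin n → ℤ) → Carrier

  record Restricts (F : Functional (suc l)) (H : Functional l) : Set ℓ where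
    field
      restrict : ∀ {δ γ} → δ ∘ inject₁ ≗ γ → δ L ≡ +0 → F δ ≈ H γ
      vanish   : ∀ {δ} → δ L ℤ.< +0 → F δ ≈ 0#
  open Restricts

  jacobiTrudi : ∀ n → (Fin n → ℤ) → Fin n → Fin n → Carrier
  jacobiTrudi n γ i j = k R e (toℕ i) (γ i ℤ.+ + toℕ j ℤ.- + toℕ i)

  k-zero : ∀ r → k R e r +0 ≈ 1#
  k-zero r = trans (+-identityˡ _) (trans (*-identityʳ _) (+-identityʳ 1#))

  k-negative : ∀ r {z} → z ℤ.< +0 → k R e r z ≈ 0#
  k-negative r { -[1+ _ ]} _         = ≈-refl
  k-negative r {+ _}       (+<+ ())

  g-restricts : Restricts (g R e (suc l)) (g R e l)
  g-restricts .restrict {δ} {γ} δ≗γ δL≡0 = trans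
    (det-unitLastRow R l (jacobiTrudi (suc l) δ) lastRow≈0 corner≈1)
    (det-cong R l λ i j → reflexive (entry≡ i j))
    where
    entry≡ : ∀ i j → jacobiTrudi (suc l) δ (inject₁ i) (inject₁ j) ≡ jacobiTrudi l γ i j
    entry≡ i j rewrite FinP.toℕ-inject₁ i | FinP.toℕ-inject₁ j | δ≗γ i = refl

    lastRow≈0 : ∀ j → jacobiTrudi (suc l) δ L (inject₁ j) ≈ 0#
    lastRow≈0 j rewrite FinP.toℕ-fromℕ l | FinP.toℕ-inject₁ j | δL≡0 =
      k-negative l (i<j⇒i-j<0 (+<+ (FinP.toℕ<n j)))

    corner≈1 : jacobiTrudi (suc l) δ L L ≈ 1#
    corner≈1 rewrite FinP.toℕ-fromℕ l | δL≡0 | ℤP.+-inverseʳ (+ l) = k-zero l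
  g-restricts .vanish {δ} δL<0 = det-zeroLastRow R l (jacobiTrudi (suc l) δ) lastRow≈0
    where
    lastRow≈0 : ∀ j → jacobiTrudi (suc l) δ L j ≈ 0#
    lastRow≈0 j rewrite FinP.toℕ-fromℕ l =
      k-negative l (i<j⇒i-j<0 (ℤP.+-mono-<-≤ δL<0 (+≤+ (FinP.toℕ≤pred[n] j))))

  lowerOp-inject₁ : ∀ {F H} b → Restricts F H →
                    Restricts (lowerOp R e (inject₁ b) F) (lowerOp R e b H)
  lowerOp-inject₁ b F↾H .restrict {δ} δ≗γ δL≡0 =
    +-cong (restrict F↾H δ≗γ δL≡0)
           (-‿cong (restrict F↾H (upd-inject₁ δ b _ δ≗γ)
                                 (≡.trans (upd-inject₁-fromℕ δ b _) δL≡0)))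
  lowerOp-inject₁ b F↾H .vanish {δ} δL<0 = trans
    (+-cong (vanish F↾H δL<0)
            (-‿cong (vanish F↾H (subst (ℤ._< +0) (≡.sym (upd-inject₁-fromℕ δ b _)) δL<0))))
    (-‿inverseʳ 0#)

  vanish-below : ∀ {F H} → Restricts F H → ∀ (δ : Fin (suc l) → ℤ) {δ′} n →
                 δ L ℤ.≤ +0 → δ′ L ≡ δ L ℤ.+ -[1+ n ] → F δ′ ≈ 0#
  vanish-below F↾H δ n δL≤0 δ′L≡ =
    vanish F↾H (subst (ℤ._< +0) (≡.sym δ′L≡) (i≤0⇒i+-[1+n]<0 n δL≤0))

  lowerOp-fromℕ : ∀ {F H} → Restricts F H → Restricts (lowerOp R e L F) H
  lowerOp-fromℕ F↾H .restrict {δ} δ≗γ δL≡0 = trans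
    (+-cong (restrict F↾H δ≗γ δL≡0)
            (-‿cong (vanish-below F↾H δ 0 (ℤP.≤-reflexive δL≡0) (upd-≡ δ L _))))
    (x-0#≈x R _)
  lowerOp-fromℕ F↾H .vanish {δ} δL<0 = trans
    (+-cong (vanish F↾H δL<0)
            (-‿cong (vanish-below F↾H δ 0 (ℤP.<⇒≤ δL<0) (upd-≡ δ L _))))
    (-‿inverseʳ 0#)

  raiseOp-inject₁ : ∀ N {F H} a b → Restricts F H →
                    Restricts (raiseOp R e N (inject₁ a , inject₁ b) F) (raiseOp R e N (a , b) H)
  raiseOp-inject₁ N a b F↾H .restrict {δ} δ≗γ δL≡0 = sumℕ-cong R (suc N) λ t →
    restrict F↾H (raise-inject₁ δ a t b δ≗γ) (≡.trans (raise-inject₁-fromℕ δ a t b) δL≡0)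
  raiseOp-inject₁ N a b F↾H .vanish {δ} δL<0 = sumℕ-≈0 R (suc N) λ t →
    vanish F↾H (subst (ℤ._< +0) (≡.sym (raise-inject₁-fromℕ δ a t b)) δL<0)

  raiseOp-fromℕ : ∀ N {F H} a → Restricts F H →
                  Restricts (raiseOp R e N (inject₁ a , L) F) H
  raiseOp-fromℕ N a F↾H .restrict {δ} δ≗γ δL≡0 = trans
    (sumℕ-head R N λ t → vanish-below F↾H δ t (ℤP.≤-reflexive δL≡0) (raise-fromℕ δ a (suc t)))
    (restrict F↾H (λ i → ≡.trans (raise-0 (inject₁ a) L δ (inject₁ i)) (δ≗γ i))
                  (≡.trans (raise-0 (inject₁ a) L δ L) δL≡0))
  raiseOp-fromℕ N a F↾H .vanish {δ} δL<0 = sumℕ-≈0 R (suc N) λ where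
    zero    → vanish F↾H (subst (ℤ._< +0) (≡.sym (raise-0 (inject₁ a) L δ L)) δL<0)
    (suc t) → vanish-below F↾H δ t (ℤP.<⇒≤ δL<0) (raise-fromℕ δ a (suc t))

  Kt-restricts : ∀ N (Ψ : Fin (suc l) → Fin (suc l) → Bool) →
                 (∀ a b → Ψ a b ≡ true → a Fin.< b) → (M : Fin (suc l) → ℕ) →
                 Restricts (Kt R e N Ψ M) (Kt R e N (Ψhat Ψ) (Mhat M))
  Kt-restricts N Ψ increasing M =
    foldr⁺ Restricts (λ { (a , refl) → raiseOp-fromℕ N a })
                     (λ { {b = a , b} refl → raiseOp-inject₁ N a b })
                     (roots-pruning Ψ increasing)
      (foldr⁺ Restricts (λ { refl → lowerOp-fromℕ })
                        (λ { {b = b} refl → lowerOp-inject₁ b })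
                        (melems-pruning M)
                        g-restricts)

lemma3p4 : ∀ {c ℓ} (R : CommutativeRing c ℓ) (e : ℕ → CommutativeRing.Carrier R)
    (l : ℕ) (Ψ : Fin (suc l) → Fin (suc l) → Bool) → IsRootIdeal Ψ →
    (M : Fin (suc l) → ℕ) (γ : Fin l → ℤ) →
    ∃[ N₀ ] (∀ N → N₀ ≤ N →
      CommutativeRing._≈_ R (Kt R e N Ψ M (ext0 γ)) (Kt R e N (Ψhat Ψ) (Mhat M) γ))
lemma3p4 R e l Ψ isRootIdeal M γ = 0 , λ N _ →
  Restricts.restrict (Kt-restricts N Ψ (proj₁ isRootIdeal) M) (ext0-inject₁ γ) (ext0-fromℕ γ)
  where open Restriction R e l
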